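{- In the DSC process, let $D^{(d)}(k,n)$ denote the number of $d$-simplices of $\mathcal{K}(n)$ whose $d$-degree equals $k$, and $N_d(n)$ the number of $d$-simplices of $\mathcal{K}(n)$. Then for $n\ge2$: $$D^{(0)}(1,n)=D^{(1)}(0,n)=N_0(n-1),\qquad D^{(0)}(2,n)=N_1(n-1),$$ and for $n\ge2$ and $1\le d\le n-1$, $$D^{(d)}(0,n)=N_{d-1}(n-1).$$
   Context: The DSC process: $\mathcal{K}(0)$ consists of a single vertex. For $n\ge 1$, $\mathcal{K}(n)$ is obtained from $\mathcal{K}(n-1)$ by adding, for every simplex $\sigma$ of $\mathcal{K}(n-1)$ (of every dimension, vertices included), a new vertex $w_\sigma$ together with the simplex $\sigma\cup\{w_\sigma\}$ and all its faces (distinct simplices receive distinct new vertices). The upper degree ($d$-degree) of a $d$-simplex is the number of $(d+1)$-simplices of the complex having it as a face; for $d=0$ it is the ordinary vertex degree in the $1$-skeleton. -}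

module Defs where

open import Data.Nat using (ℕ; zero; suc; _+_; _∸_; _⊔_)
open import Data.Nat.Properties using (_≟_)
open import Data.List using (List; []; _∷_; _++_; [_]; map; concat; length; filter; foldr; deduplicate; zip; upTo; applyUpTo)
open import Data.List.Properties using (≡-dec)
open import Data.List.Relation.Unary.All using (All)
open import Data.List.Relation.Unary.All using () renaming (all? to allDec)
open import Data.List.Membership.DecPropositional _≟_ using (_∈_; _∈?_)
open import Data.Product using (_×_; _,_)
open import Relation.Nullary using (Dec)
open import Relation.Nullary.Decidable using (_×-dec_)
open import Relation.Binary.PropositionalEquality using (_≡_)

-- A simplex is a nonempty finite set of vertices (labels in ℕ), represented
-- canonically as a strictly increasing list. A complex is a list of its
-- simplices (without repetition; the empty simplex is not included).
Simplex : Set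
Simplex = List ℕ

Complex : Set
Complex = List Simplex

_≟ˢ_ : (σ τ : Simplex) → Dec (σ ≡ τ)
_≟ˢ_ = ≡-dec _≟_

subsets : List ℕ → List (List ℕ)
subsets [] = [] ∷ []
subsets (x ∷ xs) = subsets xs ++ map (x ∷_) (subsets xs)

faces : Simplex → List Simplex
faces σ = filter (λ τ → Data.Nat.Properties._≤?_ 1 (length τ)) (subsets σ)

maxLabel : Complex → ℕ
maxLabel C = foldr _⊔_ 0 (concat C)

-- one DSC step: for the i-th simplex σ of C a fresh vertex
-- w_σ = suc (maxLabel C) + i is created (distinct simplices get distinct
-- fresh vertices, all larger than every old label, so σ ++ [ w_σ ] is again
-- increasing) and the simplex σ ∪ {w_σ} is added with all its faces.
step : Complex → Complex
step C = deduplicate _≟ˢ_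
  (C ++ concat (map (λ p → faces (Data.Product.proj₁ p ++ [ Data.Product.proj₂ p ]))
                    (zip C (applyUpTo (λ i → suc (maxLabel C) + i) (length C)))))

K : ℕ → Complex
K zero = [ 0 ] ∷ []
K (suc n) = step (K n)

_⊆?_ : (σ τ : Simplex) → Dec (All (_∈ τ) σ)
σ ⊆? τ = allDec (_∈? τ) σ

upDeg : Complex → Simplex → ℕ
upDeg C σ = length (filter (λ τ → (length τ ≟ suc (length σ)) ×-dec (σ ⊆? τ)) C)

-- N d n : number of d-simplices of K(n)  (a d-simplex has d+1 vertices)
N : ℕ → ℕ → ℕ
N d n = length (filter (λ σ → length σ ≟ suc d) (K n))

D : ℕ → ℕ → ℕ → ℕ
D d k n = length (filter (λ σ → (length σ ≟ suc d) ×-dec (upDeg (K n) σ ≟ k)) (K n))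

-- Every simplex of step C is either a simplex of C or of the form ρ ∪ {w_σ} with ρ ⊆ σ ∈ C.
-- Each simplex of C, and each ρ ∪ {w_σ} with ρ ⊊ σ, has a coface in step C, whereas the cone
-- σ ∪ {w_σ} has none (w_σ is fresh); so the d-simplices of upper degree 0 are exactly the cones
-- over the (d-1)-simplices of C. The new vertex w_σ has degree |σ|, while an old vertex v lies
-- in an edge e of C (once n ≥ 1) and so has at least the three cofaces e, {v, w_v} and {v, w_e};
-- hence the vertices of degree 1 and 2 are the w_σ for the vertices and edges σ of C.
module Submission where

open import Defs
open import Data.Empty using (⊥-elim)
open import Data.List using (List; []; _∷_; _++_; [_]; map; length; filter; foldr; zip; applyUpTo)
open import Data.List.Properties using (length-map; length-filter; length-applyUpTo; length-++; filter-none; ∷ʳ-injective)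
open import Data.List.Membership.Propositional using (_∈_; _∉_)
open import Data.List.Membership.Propositional.Properties
  using (∈-filter⁺; ∈-filter⁻; ∈-map⁺; ∈-map⁻; ∈-++⁺ˡ; ∈-++⁺ʳ; ∈-++⁻; ∈-concat⁺′; ∈-concat⁻′; ∈-deduplicate⁺; ∈-deduplicate⁻; ∈-applyUpTo⁻)
open import Data.List.Membership.Propositional.Properties.WithK using (unique∧set⇒bag)
open import Data.List.Relation.Binary.BagAndSetEquality using (∼bag⇒↭)
open import Data.List.Relation.Binary.Equality.Propositional using (≋⇒≡)
open import Data.List.Relation.Binary.Permutation.Propositional.Properties using (↭-length)
open import Data.List.Relation.Binary.Sublist.Propositional using (_⊆_; []; _∷_; _∷ʳ_; ⊆-refl; ⊆-trans; lookup; minimum; from∈)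
open import Data.List.Relation.Binary.Sublist.Propositional.Properties using (length-mono-≤; to-≋; ++⁺; ++⁺ʳ)
open import Data.List.Relation.Unary.All as All using (All; []; _∷_)
open import Data.List.Relation.Unary.AllPairs using ([]; _∷_)
open import Data.List.Relation.Unary.Any using (here; there)
open import Data.List.Relation.Unary.Unique.Propositional using (Unique)
import Data.List.Relation.Unary.Unique.Propositional.Properties as Unique
open import Data.List.Relation.Unary.Unique.DecPropositional.Properties _≟ˢ_ using (deduplicate-!)
open import Data.Nat using (ℕ; zero; suc; _≤_; _<_; _∸_; _+_; _⊔_; z≤n; s≤s)
open import Data.Nat.Properties
  using (_≟_; _≤?_; ≤-trans; ≤-reflexive; m≤m⊔n; m≤n⊔m; m≤m+n; +-comm; +-cancelˡ-≡; <⇒≢; <-irrefl; n>0⇒n≢0; m≤n⇒m<n∨m≡n; suc-injective)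
open import Data.Product using (_×_; _,_; proj₁; proj₂; ∃; ∃₂)
open import Data.Sum using (_⊎_; inj₁; inj₂)
open import Function using (_∘_; _⇔_; mk⇔)
open import Relation.Binary.Definitions using (DecidableEquality)
open import Relation.Binary.PropositionalEquality using (_≡_; _≢_; refl; sym; trans; cong; subst)
open import Relation.Nullary using (¬_; yes; no)
open import Relation.Nullary.Decidable using (_×-dec_)
open import Relation.Unary using (Decidable)

module _ {A : Set} where

  unique∧set⇒length≡ : {xs ys : List A} → Unique xs → Unique ys →
                       (∀ {z} → z ∈ xs ⇔ z ∈ ys) → length xs ≡ length ys
  unique∧set⇒length≡ ux uy xs∼ys = ↭-length (∼bag⇒↭ (unique∧set⇒bag ux uy xs∼ys))

  -- The elements of ys lying in xs form a duplicate-free list with the same elements as xs.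
  unique∧subset⇒length≤ : DecidableEquality A → {xs ys : List A} → Unique xs → Unique ys →
                          (∀ {z} → z ∈ xs → z ∈ ys) → length xs ≤ length ys
  unique∧subset⇒length≤ _≟ᴬ_ {xs} {ys} ux uy xs⊆ys = ≤-trans
    (≤-reflexive (unique∧set⇒length≡ ux (Unique.filter⁺ (_∈? xs) {ys} uy)
      (mk⇔ (λ z∈xs → ∈-filter⁺ (_∈? xs) (xs⊆ys z∈xs) z∈xs)
           (λ z∈ → proj₂ (∈-filter⁻ (_∈? xs) {xs = ys} z∈)))))
    (length-filter (_∈? xs) ys)
    where open import Data.List.Membership.DecPropositional _≟ᴬ_ using (_∈?_)

  length-snoc : (xs : List A) (x : A) → length (xs ++ [ x ]) ≡ suc (length xs)
  length-snoc xs x = trans (length-++ xs) (+-comm (length xs) 1)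

  1≤length-snoc : (xs : List A) (x : A) → 1 ≤ length (xs ++ [ x ])
  1≤length-snoc xs x = subst (1 ≤_) (sym (length-snoc xs x)) (s≤s z≤n)

  length≡1⇒singleton : {xs : List A} → length xs ≡ 1 → ∃ λ x → xs ≡ [ x ]
  length≡1⇒singleton {x ∷ []} refl = x , refl

module _ {A B : Set} (f : A → B) where

  InjectiveOn : List A → Set
  InjectiveOn xs = ∀ {a a′} → a ∈ xs → a′ ∈ xs → f a ≡ f a′ → a ≡ a′

  map-unique : {xs : List A} → Unique xs → InjectiveOn xs → Unique (map f xs)
  map-unique {[]}     []           _   = []
  map-unique {x ∷ xs} (x∉xs ∷ uxs) inj =
    All.tabulate fx∉ ∷ map-unique uxs (λ a∈ a′∈ → inj (there a∈) (there a′∈))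
    where
    fx∉ : ∀ {y} → y ∈ map f xs → f x ≢ y
    fx∉ y∈ fx≡y with ∈-map⁻ f y∈
    ... | a , a∈ , refl = All.lookup x∉xs a∈ (inj (here refl) (there a∈) fx≡y)

  bijectionOn⇒length≡ : {xs : List A} {ys : List B} → Unique xs → InjectiveOn xs → Unique ys →
                        (∀ {a} → a ∈ xs → f a ∈ ys) →
                        (∀ {b} → b ∈ ys → ∃ λ a → a ∈ xs × b ≡ f a) →
                        length ys ≡ length xs
  bijectionOn⇒length≡ {xs} ux inj uy into onto =
    trans (unique∧set⇒length≡ uy (map-unique ux inj) (mk⇔ to from)) (length-map f xs)
    where
    to : ∀ {b} → b ∈ _ → b ∈ map f xs
    to b∈ with onto b∈
    ... | a , a∈ , refl = ∈-map⁺ f a∈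
    from : ∀ {b} → b ∈ map f xs → b ∈ _
    from b∈ with ∈-map⁻ f b∈
    ... | a , a∈ , refl = into a∈

module _ {A B : Set} where

  ∈-zip⁻ˡ : ∀ {a b} {xs : List A} {ys : List B} → (a , b) ∈ zip xs ys → a ∈ xs
  ∈-zip⁻ˡ {xs = _ ∷ _} {_ ∷ _} (here refl) = here refl
  ∈-zip⁻ˡ {xs = _ ∷ _} {_ ∷ _} (there ab∈) = there (∈-zip⁻ˡ ab∈)

  ∈-zip⁻ʳ : ∀ {a b} {xs : List A} {ys : List B} → (a , b) ∈ zip xs ys → b ∈ ys
  ∈-zip⁻ʳ {xs = _ ∷ _} {_ ∷ _} (here refl) = here refl
  ∈-zip⁻ʳ {xs = _ ∷ _} {_ ∷ _} (there ab∈) = there (∈-zip⁻ʳ ab∈)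

  ∈-zip⁺ : ∀ {a} {xs : List A} {ys : List B} → length xs ≤ length ys → a ∈ xs →
           ∃ λ b → (a , b) ∈ zip xs ys
  ∈-zip⁺ {xs = _ ∷ _} {y ∷ _} _         (here refl) = y , here refl
  ∈-zip⁺ {xs = _ ∷ _} {_ ∷ _} (s≤s len) (there a∈)  with ∈-zip⁺ len a∈
  ... | b , ab∈ = b , there ab∈

  zip-uniqueˡ : {xs : List A} {ys : List B} → Unique xs → Unique (zip xs ys)
  zip-uniqueˡ {[]}    _            = []
  zip-uniqueˡ {_ ∷ _} {[]} _       = []
  zip-uniqueˡ {_ ∷ _} {_ ∷ _} (x∉xs ∷ uxs) =
    All.tabulate (λ { ab∈ refl → All.lookup x∉xs (∈-zip⁻ˡ ab∈) refl }) ∷ zip-uniqueˡ uxs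

  zip-injectiveʳ : ∀ {a a′ b} {xs : List A} {ys : List B} → Unique ys →
                   (a , b) ∈ zip xs ys → (a′ , b) ∈ zip xs ys → a ≡ a′
  zip-injectiveʳ {xs = _ ∷ _} {_ ∷ _} _            (here refl) (here refl) = refl
  zip-injectiveʳ {xs = _ ∷ _} {_ ∷ _} (y∉ys ∷ _)   (here refl) (there b∈)  =
    ⊥-elim (All.lookup y∉ys (∈-zip⁻ʳ b∈) refl)
  zip-injectiveʳ {xs = _ ∷ _} {_ ∷ _} (y∉ys ∷ _)   (there b∈)  (here refl) =
    ⊥-elim (All.lookup y∉ys (∈-zip⁻ʳ b∈) refl)
  zip-injectiveʳ {xs = _ ∷ _} {_ ∷ _} (_ ∷ uys)    (there b∈)  (there b∈′) =
    zip-injectiveʳ uys b∈ b∈′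

  length-filter-zip : ∀ {p} {P : A → Set p} (P? : Decidable P) (xs : List A) {ys : List B} →
                      length xs ≤ length ys →
                      length (filter (P? ∘ proj₁) (zip xs ys)) ≡ length (filter P? xs)
  length-filter-zip P? []       _         = refl
  length-filter-zip P? (x ∷ xs) {_ ∷ _} (s≤s len) with P? x
  ... | yes _ = cong suc (length-filter-zip P? xs len)
  ... | no  _ = length-filter-zip P? xs len

module _ {A : Set} where

  ⊆-length-≡⇒≡ : {xs ys : List A} → xs ⊆ ys → length xs ≡ length ys → xs ≡ ys
  ⊆-length-≡⇒≡ xs⊆ys len = ≋⇒≡ (to-≋ len xs⊆ys)

  ⊆-extend : {xs ys : List A} → xs ⊆ ys → length xs < length ys →
             ∃ λ zs → xs ⊆ zs × zs ⊆ ys × length zs ≡ suc (length xs)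
  ⊆-extend {xs} (y ∷ʳ xs⊆ys) _ = y ∷ xs , y ∷ʳ ⊆-refl , refl ∷ xs⊆ys , refl
  ⊆-extend (refl ∷ xs⊆ys) (s≤s len) with ⊆-extend xs⊆ys len
  ... | zs , xs⊆zs , zs⊆ys , len′ = _ ∷ zs , refl ∷ xs⊆zs , refl ∷ zs⊆ys , cong suc len′

  ⊆-snoc⁻ : ∀ {xs} (ys : List A) {w} → xs ⊆ ys ++ [ w ] →
            xs ⊆ ys ⊎ ∃ λ zs → zs ⊆ ys × xs ≡ zs ++ [ w ]
  ⊆-snoc⁻ []       (_ ∷ʳ [])    = inj₁ []
  ⊆-snoc⁻ []       (refl ∷ [])  = inj₂ ([] , [] , refl)
  ⊆-snoc⁻ (y ∷ ys) (_ ∷ʳ xs⊆)   with ⊆-snoc⁻ ys xs⊆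
  ... | inj₁ xs⊆ys               = inj₁ (y ∷ʳ xs⊆ys)
  ... | inj₂ (zs , zs⊆ys , refl) = inj₂ (zs , y ∷ʳ zs⊆ys , refl)
  ⊆-snoc⁻ (y ∷ ys) (refl ∷ xs⊆) with ⊆-snoc⁻ ys xs⊆
  ... | inj₁ xs⊆ys               = inj₁ (refl ∷ xs⊆ys)
  ... | inj₂ (zs , zs⊆ys , refl) = inj₂ (y ∷ zs , refl ∷ zs⊆ys , refl)

  ⊆⇒All∈ : {xs ys : List A} → xs ⊆ ys → All (_∈ ys) xs
  ⊆⇒All∈ xs⊆ys = All.tabulate (lookup xs⊆ys)

  unique-⊆ : {xs ys : List A} → xs ⊆ ys → Unique ys → Unique xs
  unique-⊆ []              _            = []
  unique-⊆ (_ ∷ʳ xs⊆ys)    (_ ∷ uys)    = unique-⊆ xs⊆ys uys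
  unique-⊆ (refl ∷ xs⊆ys)  (y∉ys ∷ uys) =
    All.tabulate (λ x∈xs → All.lookup y∉ys (lookup xs⊆ys x∈xs)) ∷ unique-⊆ xs⊆ys uys

  snoc-unique : {xs : List A} {w : A} → Unique xs → w ∉ xs → Unique (xs ++ [ w ])
  snoc-unique {[]}     []           _    = [] ∷ []
  snoc-unique {x ∷ xs} (x∉xs ∷ uxs) w∉ =
    All.tabulate x≢ ∷ snoc-unique uxs (w∉ ∘ there)
    where
    x≢ : ∀ {y} → y ∈ xs ++ [ _ ] → x ≢ y
    x≢ y∈ refl with ∈-++⁻ xs y∈
    ... | inj₁ x∈xs        = All.lookup x∉xs x∈xs refl
    ... | inj₂ (here refl) = w∉ (here refl)

∈-subsets⁺ : ∀ {τ ρ} → τ ⊆ ρ → τ ∈ subsets ρ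
∈-subsets⁺ []                          = here refl
∈-subsets⁺ (_ ∷ʳ τ⊆ρ)                  = ∈-++⁺ˡ (∈-subsets⁺ τ⊆ρ)
∈-subsets⁺ {ρ = x ∷ ρ} (refl ∷ τ⊆ρ)   = ∈-++⁺ʳ (subsets ρ) (∈-map⁺ (x ∷_) (∈-subsets⁺ τ⊆ρ))

∈-subsets⁻ : ∀ {τ} ρ → τ ∈ subsets ρ → τ ⊆ ρ
∈-subsets⁻ []       (here refl) = []
∈-subsets⁻ (x ∷ ρ)  τ∈ with ∈-++⁻ (subsets ρ) τ∈
... | inj₁ τ∈′ = x ∷ʳ ∈-subsets⁻ ρ τ∈′
... | inj₂ τ∈′ with ∈-map⁻ (x ∷_) τ∈′
... | τ′ , τ′∈ , refl = refl ∷ ∈-subsets⁻ ρ τ′∈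

∈-faces⁺ : ∀ {τ ρ} → τ ⊆ ρ → 1 ≤ length τ → τ ∈ faces ρ
∈-faces⁺ τ⊆ρ nonEmpty = ∈-filter⁺ (λ τ → 1 ≤? length τ) (∈-subsets⁺ τ⊆ρ) nonEmpty

∈-faces⁻ : ∀ {τ ρ} → τ ∈ faces ρ → τ ⊆ ρ × 1 ≤ length τ
∈-faces⁻ {ρ = ρ} τ∈ with ∈-filter⁻ (λ τ → 1 ≤? length τ) τ∈
... | τ∈subsets , nonEmpty = ∈-subsets⁻ ρ τ∈subsets , nonEmpty

≤-foldr-⊔ : ∀ {x xs} → x ∈ xs → x ≤ foldr _⊔_ 0 xs
≤-foldr-⊔ {xs = y ∷ _} (here refl) = m≤m⊔n y _
≤-foldr-⊔ {xs = y ∷ _} (there x∈)  = ≤-trans (≤-foldr-⊔ x∈) (m≤n⊔m y _)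

≤-maxLabel : ∀ {C τ v} → τ ∈ C → v ∈ τ → v ≤ maxLabel C
≤-maxLabel τ∈C v∈τ = ≤-foldr-⊔ (∈-concat⁺′ v∈τ τ∈C)

record IsComplex (C : Complex) : Set where
  field
    unique        : Unique C
    nonEmpty      : ∀ {τ} → τ ∈ C → 1 ≤ length τ
    downClosed    : ∀ {τ ρ} → τ ∈ C → ρ ⊆ τ → 1 ≤ length ρ → ρ ∈ C
    simplexUnique : ∀ {τ} → τ ∈ C → Unique τ

module Step (C : Complex) where

  apexLabels : List ℕ
  apexLabels = applyUpTo (λ i → suc (maxLabel C) + i) (length C)

  apexPairs : List (Simplex × ℕ)
  apexPairs = zip C apexLabels

  -- Apex σ w : w is the new vertex w_σ that one DSC step attaches to σ ∈ C.
  Apex : Simplex → ℕ → Set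
  Apex σ w = (σ , w) ∈ apexPairs

  length-C≤length-apexLabels : length C ≤ length apexLabels
  length-C≤length-apexLabels = ≤-reflexive (sym (length-applyUpTo _ (length C)))

  apexLabels-unique : Unique apexLabels
  apexLabels-unique = Unique.applyUpTo⁺₁ _ (length C)
    (λ i<j _ w≡w′ → <⇒≢ i<j (+-cancelˡ-≡ (suc (maxLabel C)) _ _ w≡w′))

  apex-∈ : ∀ {σ w} → Apex σ w → σ ∈ C
  apex-∈ = ∈-zip⁻ˡ

  apex-exists : ∀ {σ} → σ ∈ C → ∃ (Apex σ)
  apex-exists = ∈-zip⁺ length-C≤length-apexLabels

  apex-injective : ∀ {σ σ′ w} → Apex σ w → Apex σ′ w → σ ≡ σ′
  apex-injective = zip-injectiveʳ apexLabels-unique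

  maxLabel<apex : ∀ {σ w} → Apex σ w → maxLabel C < w
  maxLabel<apex σw with ∈-applyUpTo⁻ _ (∈-zip⁻ʳ σw)
  ... | i , _ , refl = s≤s (m≤m+n (maxLabel C) i)

  apex-fresh : ∀ {τ σ w} → τ ∈ C → Apex σ w → w ∉ τ
  apex-fresh τ∈C σw w∈τ = <-irrefl refl (≤-trans (maxLabel<apex σw) (≤-maxLabel τ∈C w∈τ))

  apexPairs-unique : Unique C → Unique apexPairs
  apexPairs-unique = zip-uniqueˡ

  length-filter-apexPairs : ∀ {p} {P : Simplex → Set p} (P? : Decidable P) →
                            length (filter (P? ∘ proj₁) apexPairs) ≡ length (filter P? C)
  length-filter-apexPairs P? = length-filter-zip P? C length-C≤length-apexLabels

  cone : Simplex × ℕ → Simplex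
  cone (σ , w) = σ ++ [ w ]

  ∈-step⁺ˡ : ∀ {τ} → τ ∈ C → τ ∈ step C
  ∈-step⁺ˡ τ∈C = ∈-deduplicate⁺ _≟ˢ_ (∈-++⁺ˡ τ∈C)

  ∈-step⁺ʳ : ∀ {σ w τ} → Apex σ w → τ ⊆ σ ++ [ w ] → 1 ≤ length τ → τ ∈ step C
  ∈-step⁺ʳ σw τ⊆ nonEmpty = ∈-deduplicate⁺ _≟ˢ_ (∈-++⁺ʳ C
    (∈-concat⁺′ (∈-faces⁺ τ⊆ nonEmpty) (∈-map⁺ (faces ∘ cone) σw)))

  ∈-step⁻ : ∀ {τ} → τ ∈ step C →
            τ ∈ C ⊎ ∃₂ λ σ w → Apex σ w × τ ⊆ σ ++ [ w ] × 1 ≤ length τ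
  ∈-step⁻ τ∈ with ∈-++⁻ C (∈-deduplicate⁻ _≟ˢ_ _ τ∈)
  ... | inj₁ τ∈C = inj₁ τ∈C
  ... | inj₂ τ∈new with ∈-concat⁻′ _ τ∈new
  ... | _ , τ∈faces , faces∈ with ∈-map⁻ (faces ∘ cone) faces∈
  ... | (σ , w) , σw , refl with ∈-faces⁻ τ∈faces
  ... | τ⊆ , nonEmpty = inj₂ (σ , w , σw , τ⊆ , nonEmpty)

step-isComplex : ∀ {C} → IsComplex C → IsComplex (step C)
step-isComplex {C} isC = record
  { unique        = deduplicate-! _
  ; nonEmpty      = nonEmpty′
  ; downClosed    = downClosed′
  ; simplexUnique = simplexUnique′
  }
  where
  open IsComplex isC
  open Step C

  nonEmpty′ : ∀ {τ} → τ ∈ step C → 1 ≤ length τ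
  nonEmpty′ τ∈ with ∈-step⁻ τ∈
  ... | inj₁ τ∈C                = nonEmpty τ∈C
  ... | inj₂ (_ , _ , _ , _ , ne) = ne

  downClosed′ : ∀ {τ ρ} → τ ∈ step C → ρ ⊆ τ → 1 ≤ length ρ → ρ ∈ step C
  downClosed′ τ∈ ρ⊆τ ne with ∈-step⁻ τ∈
  ... | inj₁ τ∈C                   = ∈-step⁺ˡ (downClosed τ∈C ρ⊆τ ne)
  ... | inj₂ (_ , _ , σw , τ⊆ , _) = ∈-step⁺ʳ σw (⊆-trans ρ⊆τ τ⊆) ne

  simplexUnique′ : ∀ {τ} → τ ∈ step C → Unique τ
  simplexUnique′ τ∈ with ∈-step⁻ τ∈
  ... | inj₁ τ∈C                   = simplexUnique τ∈C
  ... | inj₂ (σ , _ , σw , τ⊆ , _) =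
    unique-⊆ τ⊆ (snoc-unique (simplexUnique (apex-∈ σw)) (apex-fresh (apex-∈ σw) σw))

K-isComplex : ∀ n → IsComplex (K n)
K-isComplex zero = record
  { unique        = [] ∷ []
  ; nonEmpty      = λ { (here refl) → s≤s z≤n }
  ; downClosed    = λ { (here refl) (_ ∷ʳ []) () ; (here refl) (refl ∷ []) _ → here refl }
  ; simplexUnique = λ { (here refl) → [] ∷ [] }
  }
K-isComplex (suc n) = step-isComplex (K-isComplex n)

IsCoface : Simplex → Simplex → Set
IsCoface σ τ = length τ ≡ suc (length σ) × All (_∈ τ) σ

coface? : (σ : Simplex) → Decidable (IsCoface σ)
coface? σ τ = (length τ ≟ suc (length σ)) ×-dec (σ ⊆? τ)

upDeg-≥ : ∀ {C σ} (τs : List Simplex) → Unique C → Unique τs →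
          (∀ {τ} → τ ∈ τs → τ ∈ C × IsCoface σ τ) → length τs ≤ upDeg C σ
upDeg-≥ {σ = σ} τs uC uτs cofaces = unique∧subset⇒length≤ _≟ˢ_ uτs (Unique.filter⁺ (coface? σ) uC)
  (λ τ∈ → let (τ∈C , cof) = cofaces τ∈ in ∈-filter⁺ (coface? σ) τ∈C cof)

coface⇒upDeg≥1 : ∀ {C σ τ} → Unique C → τ ∈ C → IsCoface σ τ → 1 ≤ upDeg C σ
coface⇒upDeg≥1 {τ = τ} uC τ∈C cof = upDeg-≥ (τ ∷ []) uC ([] ∷ []) λ { (here refl) → τ∈C , cof }

upDeg≡0 : ∀ {C σ} → (∀ {τ} → τ ∈ C → ¬ IsCoface σ τ) → upDeg C σ ≡ 0
upDeg≡0 {σ = σ} noCoface = cong length (filter-none (coface? σ) (All.tabulate noCoface))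

#Simplices : Complex → ℕ → ℕ
#Simplices C d = length (filter (λ σ → length σ ≟ suc d) C)

#SimplicesOfUpDeg : Complex → ℕ → ℕ → ℕ
#SimplicesOfUpDeg C d k = length (filter (λ σ → (length σ ≟ suc d) ×-dec (upDeg C σ ≟ k)) C)

VerticesInEdges : Complex → Set
VerticesInEdges C = ∀ {v} → [ v ] ∈ C → ∃ λ e → e ∈ C × length e ≡ 2 × v ∈ e

module StepDegrees {C : Complex} (isC : IsComplex C) where

  open IsComplex isC
  open Step C public

  step-unique : Unique (step C)
  step-unique = IsComplex.unique (step-isComplex isC)

  data Origin (τ : Simplex) : Set where
    old : τ ∈ C → Origin τ
    new : ∀ {σ w ρ} → Apex σ w → ρ ⊆ σ → τ ≡ ρ ++ [ w ] → Origin τ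

  origin : ∀ {τ} → τ ∈ step C → Origin τ
  origin τ∈ with ∈-step⁻ τ∈
  ... | inj₁ τ∈C = old τ∈C
  ... | inj₂ (σ , w , σw , τ⊆ , ne) with ⊆-snoc⁻ σ τ⊆
  ...   | inj₁ τ⊆σ             = old (downClosed (apex-∈ σw) τ⊆σ ne)
  ...   | inj₂ (_ , ρ⊆σ , τ≡) = new σw ρ⊆σ τ≡

  apex-∈-new⇒≡ : ∀ {σ w σ′ w′ ρ} → Apex σ w → Apex σ′ w′ → ρ ⊆ σ′ → w ∈ ρ ++ [ w′ ] →
               σ ≡ σ′ × w ≡ w′
  apex-∈-new⇒≡ {ρ = ρ} σw σ′w′ ρ⊆σ′ w∈ with ∈-++⁻ ρ w∈
  ... | inj₁ w∈ρ         = ⊥-elim (apex-fresh (apex-∈ σ′w′) σw (lookup ρ⊆σ′ w∈ρ))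
  ... | inj₂ (here refl) = apex-injective σw σ′w′ , refl

  upDeg-old≥1 : ∀ {τ} → τ ∈ C → 1 ≤ upDeg (step C) τ
  upDeg-old≥1 {τ} τ∈C with apex-exists τ∈C
  ... | w , τw = coface⇒upDeg≥1 step-unique (∈-step⁺ʳ τw ⊆-refl (1≤length-snoc τ w))
                  (length-snoc τ w , ⊆⇒All∈ (++⁺ʳ [ w ] ⊆-refl))

  upDeg-partialCone≥1 : ∀ {σ w ρ} → Apex σ w → ρ ⊆ σ → length ρ < length σ →
                        1 ≤ upDeg (step C) (ρ ++ [ w ])
  upDeg-partialCone≥1 {w = w} {ρ} σw ρ⊆σ ρ<σ with ⊆-extend ρ⊆σ ρ<σ
  ... | ρ′ , ρ⊆ρ′ , ρ′⊆σ , ρ′≡1+ρ = coface⇒upDeg≥1 step-unique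
          (∈-step⁺ʳ σw (++⁺ ρ′⊆σ ⊆-refl) (1≤length-snoc ρ′ w))
          (trans (length-snoc ρ′ w) (cong suc (trans ρ′≡1+ρ (sym (length-snoc ρ w)))) ,
           ⊆⇒All∈ (++⁺ ρ⊆ρ′ ⊆-refl))

  upDeg-cone≡0 : ∀ {σ w} → Apex σ w → upDeg (step C) (σ ++ [ w ]) ≡ 0
  upDeg-cone≡0 {σ} {w} σw = upDeg≡0 noCoface
    where
    noCoface : ∀ {τ} → τ ∈ step C → ¬ IsCoface (σ ++ [ w ]) τ
    noCoface τ∈ (len , σw⊆τ) with origin τ∈ | All.lookup σw⊆τ (∈-++⁺ʳ σ (here refl))
    ... | old τ∈C              | w∈τ = apex-fresh τ∈C σw w∈τ
    ... | new σ′w′ ρ⊆σ′ refl   | w∈τ with apex-∈-new⇒≡ σw σ′w′ ρ⊆σ′ w∈τ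
    ...   | refl , refl = <-irrefl refl (subst (_≤ length (σ ++ [ w ])) len
                                               (length-mono-≤ (++⁺ ρ⊆σ′ ⊆-refl)))

  upDeg-apexVertex : ∀ {σ w} → Apex σ w → upDeg (step C) [ w ] ≡ length σ
  upDeg-apexVertex {σ} {w} σw =
    bijectionOn⇒length≡ edge (simplexUnique (apex-∈ σw)) (λ _ _ → edge-injective)
                        (Unique.filter⁺ (coface? [ w ]) step-unique) into onto
    where
    edge : ℕ → Simplex
    edge a = a ∷ w ∷ []
    edge-injective : ∀ {a b} → edge a ≡ edge b → a ≡ b
    edge-injective refl = refl
    into : ∀ {a} → a ∈ σ → edge a ∈ filter (coface? [ w ]) (step C)
    into a∈σ = ∈-filter⁺ (coface? [ w ]) (∈-step⁺ʳ σw (++⁺ (from∈ a∈σ) ⊆-refl) (s≤s z≤n))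
                 (refl , there (here refl) ∷ [])
    onto : ∀ {τ} → τ ∈ filter (coface? [ w ]) (step C) → ∃ λ a → a ∈ σ × τ ≡ edge a
    onto τ∈ with ∈-filter⁻ (coface? [ w ]) τ∈
    ... | τ∈′ , len , w∈τ ∷ [] with origin τ∈′
    ...   | old τ∈C = ⊥-elim (apex-fresh τ∈C σw w∈τ)
    ...   | new {ρ = ρ} σ′w′ ρ⊆σ′ refl with apex-∈-new⇒≡ σw σ′w′ ρ⊆σ′ w∈τ
    ...     | refl , refl
            with length≡1⇒singleton {xs = ρ} (suc-injective (trans (sym (length-snoc ρ w)) len))
    ...       | a , refl = a , lookup ρ⊆σ′ (here refl) , refl

  oldVertex-inEdge : ∀ {v} → [ v ] ∈ C → ∃ λ e → e ∈ step C × length e ≡ 2 × v ∈ e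
  oldVertex-inEdge {v} v∈C with apex-exists v∈C
  ... | w , vw = v ∷ w ∷ [] , ∈-step⁺ʳ vw ⊆-refl (s≤s z≤n) , refl , here refl

  apexVertex-inEdge : ∀ {σ w} → Apex σ w → ∃ λ e → e ∈ step C × length e ≡ 2 × w ∈ e
  apexVertex-inEdge {[]}    σw with nonEmpty (apex-∈ σw)
  ... | ()
  apexVertex-inEdge {x ∷ σ} {w} σw =
    x ∷ w ∷ [] , ∈-step⁺ʳ σw (refl ∷ ++⁺ (minimum σ) ⊆-refl) (s≤s z≤n) , refl , there (here refl)

  step-verticesInEdges : VerticesInEdges (step C)
  step-verticesInEdges v∈ with origin v∈
  ... | old v∈C = oldVertex-inEdge v∈C
  ... | new {ρ = ρ} σw _ v≡ρw with ∷ʳ-injective [] ρ v≡ρw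
  ...   | _ , refl = apexVertex-inEdge σw

  upDeg-oldVertex≥3 : VerticesInEdges C → ∀ {v} → [ v ] ∈ C → 3 ≤ upDeg (step C) [ v ]
  upDeg-oldVertex≥3 inEdges {v} v∈C with inEdges v∈C | apex-exists v∈C
  ... | e , e∈C , len-e , v∈e | w₁ , vw₁ with apex-exists e∈C
  ...   | w₂ , ew₂ = upDeg-≥ (e ∷ (v ∷ w₁ ∷ []) ∷ (v ∷ w₂ ∷ []) ∷ []) step-unique distinct cofaces
    where
    e≢vw₁ : e ≢ v ∷ w₁ ∷ []
    e≢vw₁ refl = apex-fresh e∈C vw₁ (there (here refl))
    e≢vw₂ : e ≢ v ∷ w₂ ∷ []
    e≢vw₂ refl = apex-fresh e∈C ew₂ (there (here refl))
    vw₁≢vw₂ : v ∷ w₁ ∷ [] ≢ v ∷ w₂ ∷ []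
    vw₁≢vw₂ refl with trans (cong length (apex-injective vw₁ ew₂)) len-e
    ... | ()
    distinct : Unique (e ∷ (v ∷ w₁ ∷ []) ∷ (v ∷ w₂ ∷ []) ∷ [])
    distinct = (e≢vw₁ ∷ e≢vw₂ ∷ []) ∷ (vw₁≢vw₂ ∷ []) ∷ [] ∷ []
    cofaces : ∀ {τ} → τ ∈ e ∷ (v ∷ w₁ ∷ []) ∷ (v ∷ w₂ ∷ []) ∷ [] → τ ∈ step C × IsCoface [ v ] τ
    cofaces (here refl)                 = ∈-step⁺ˡ e∈C , len-e , v∈e ∷ []
    cofaces (there (here refl))         = ∈-step⁺ʳ vw₁ ⊆-refl (s≤s z≤n) , refl , here refl ∷ []
    cofaces (there (there (here refl))) =
      ∈-step⁺ʳ ew₂ (++⁺ (from∈ v∈e) ⊆-refl) (s≤s z≤n) , refl , here refl ∷ []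

  upDeg≡0⇒cone : ∀ {τ} → τ ∈ step C → upDeg (step C) τ ≡ 0 → ∃₂ λ σ w → Apex σ w × τ ≡ σ ++ [ w ]
  upDeg≡0⇒cone τ∈ deg≡0 with origin τ∈
  ... | old τ∈C = ⊥-elim (n>0⇒n≢0 (upDeg-old≥1 τ∈C) deg≡0)
  ... | new σw ρ⊆σ refl with m≤n⇒m<n∨m≡n (length-mono-≤ ρ⊆σ)
  ...   | inj₁ ρ<σ = ⊥-elim (n>0⇒n≢0 (upDeg-partialCone≥1 σw ρ⊆σ ρ<σ) deg≡0)
  ...   | inj₂ ρ≡σ with ⊆-length-≡⇒≡ ρ⊆σ ρ≡σ
  ...     | refl = _ , _ , σw , refl

  vertexUpDeg≤2⇒apex : VerticesInEdges C → ∀ {u} → [ u ] ∈ step C → upDeg (step C) [ u ] ≤ 2 →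
                       ∃ λ σ → Apex σ u
  vertexUpDeg≤2⇒apex inEdges u∈ deg≤2 with origin u∈
  ... | old u∈C = ⊥-elim (<-irrefl refl (≤-trans (upDeg-oldVertex≥3 inEdges u∈C) deg≤2))
  ... | new {ρ = ρ} σw _ u≡ρw with ∷ʳ-injective [] ρ u≡ρw
  ...   | _ , refl = _ , σw

  count-by-apexes : ∀ d {p} {P : Simplex → Set p} (P? : Decidable P) (g : Simplex × ℕ → Simplex) →
                    (∀ {σ w σ′ w′} → Apex σ w → Apex σ′ w′ →
                       g (σ , w) ≡ g (σ′ , w′) → (σ , w) ≡ (σ′ , w′)) →
                    (∀ {σ w} → Apex σ w → length σ ≡ suc d → g (σ , w) ∈ step C × P (g (σ , w))) →
                    (∀ {τ} → τ ∈ step C → P τ →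
                       ∃₂ λ σ w → Apex σ w × length σ ≡ suc d × τ ≡ g (σ , w)) →
                    length (filter P? (step C)) ≡ #Simplices C d
  count-by-apexes d P? g g-injective into onto = trans
    (bijectionOn⇒length≡ g (Unique.filter⁺ Q? (apexPairs-unique unique)) injectiveOn
                          (Unique.filter⁺ P? step-unique) into′ onto′)
    (length-filter-apexPairs (λ σ → length σ ≟ suc d))
    where
    Q? = λ (p : Simplex × ℕ) → length (proj₁ p) ≟ suc d
    injectiveOn : InjectiveOn g (filter Q? apexPairs)
    injectiveOn p∈ p′∈ = g-injective (proj₁ (∈-filter⁻ Q? p∈)) (proj₁ (∈-filter⁻ Q? p′∈))
    into′ : ∀ {p} → p ∈ filter Q? apexPairs → g p ∈ filter P? (step C)
    into′ p∈ with ∈-filter⁻ Q? p∈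
    ... | σw , len with into σw len
    ...   | g∈ , Pg = ∈-filter⁺ P? g∈ Pg
    onto′ : ∀ {τ} → τ ∈ filter P? (step C) → ∃ λ p → p ∈ filter Q? apexPairs × τ ≡ g p
    onto′ τ∈ with ∈-filter⁻ P? {xs = step C} τ∈
    ... | τ∈′ , Pτ with onto τ∈′ Pτ
    ...   | σ , w , σw , len , refl = (σ , w) , ∈-filter⁺ Q? σw len , refl

  #upDeg0-step : ∀ d → #SimplicesOfUpDeg (step C) (suc d) 0 ≡ #Simplices C d
  #upDeg0-step d = count-by-apexes d _ cone cone-injective into onto
    where
    cone-injective : ∀ {σ w σ′ w′} → Apex σ w → Apex σ′ w′ →
                     σ ++ [ w ] ≡ σ′ ++ [ w′ ] → (σ , w) ≡ (σ′ , w′)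
    cone-injective {σ} {σ′ = σ′} _ _ eq with ∷ʳ-injective σ σ′ eq
    ... | refl , refl = refl
    into : ∀ {σ w} → Apex σ w → length σ ≡ suc d →
           σ ++ [ w ] ∈ step C × length (σ ++ [ w ]) ≡ suc (suc d) × upDeg (step C) (σ ++ [ w ]) ≡ 0
    into {σ} {w} σw len = ∈-step⁺ʳ σw ⊆-refl (1≤length-snoc σ w) ,
                          trans (length-snoc σ w) (cong suc len) , upDeg-cone≡0 σw
    onto : ∀ {τ} → τ ∈ step C → length τ ≡ suc (suc d) × upDeg (step C) τ ≡ 0 →
           ∃₂ λ σ w → Apex σ w × length σ ≡ suc d × τ ≡ σ ++ [ w ]
    onto τ∈ (len , deg≡0) with upDeg≡0⇒cone τ∈ deg≡0
    ... | σ , w , σw , refl = σ , w , σw , suc-injective (trans (sym (length-snoc σ w)) len) , refl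

  #vertexUpDeg-step : VerticesInEdges C → ∀ j → j ≤ 1 →
                      #SimplicesOfUpDeg (step C) 0 (suc j) ≡ #Simplices C j
  #vertexUpDeg-step inEdges j j≤1 =
    count-by-apexes j _ (λ (_ , w) → [ w ]) vertex-injective into onto
    where
    vertex-injective : ∀ {σ w σ′ w′} → Apex σ w → Apex σ′ w′ → [ w ] ≡ [ w′ ] → (σ , w) ≡ (σ′ , w′)
    vertex-injective {w = w} σw σ′w refl = cong (_, w) (apex-injective σw σ′w)
    into : ∀ {σ w} → Apex σ w → length σ ≡ suc j →
           [ w ] ∈ step C × length [ w ] ≡ 1 × upDeg (step C) [ w ] ≡ suc j
    into {σ} σw len =
      ∈-step⁺ʳ σw (++⁺ (minimum σ) ⊆-refl) (s≤s z≤n) , refl , trans (upDeg-apexVertex σw) len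
    onto : ∀ {τ} → τ ∈ step C → length τ ≡ 1 × upDeg (step C) τ ≡ suc j →
           ∃₂ λ σ w → Apex σ w × length σ ≡ suc j × τ ≡ [ w ]
    onto {τ} τ∈ (len , deg) with length≡1⇒singleton {xs = τ} len
    ... | u , refl with vertexUpDeg≤2⇒apex inEdges τ∈ (subst (_≤ 2) (sym deg) (s≤s j≤1))
    ...   | σ , σu = σ , u , σu , trans (sym (upDeg-apexVertex σu)) deg , refl

mainTheorem8 : (n : ℕ) → 2 ≤ n →
    (D 0 1 n ≡ N 0 (n ∸ 1)) × (D 1 0 n ≡ N 0 (n ∸ 1)) × (D 0 2 n ≡ N 1 (n ∸ 1))
    × ((d : ℕ) → 1 ≤ d → d ≤ n ∸ 1 → D d 0 n ≡ N (d ∸ 1) (n ∸ 1))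
mainTheorem8 (suc zero)    (s≤s ())
mainTheorem8 (suc (suc n)) _ =
  #vertexUpDeg-step inEdges 0 z≤n , #upDeg0-step 0 , #vertexUpDeg-step inEdges 1 (s≤s z≤n) ,
  λ { (suc d) _ _ → #upDeg0-step d }
  where
  open StepDegrees (K-isComplex (suc n))
  inEdges : VerticesInEdges (K (suc n))
  inEdges = StepDegrees.step-verticesInEdges (K-isComplex n)
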